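{- For every closed formula $A$: if $\models_{\mathfrak B}A$ for every birelational model $\mathfrak B$, then $\models_{\mathfrak P}A$ for every predicate model $\mathfrak P$.
   Context: Formulas: $A ::= P \mid X \mid A\to B \mid \Box A \mid \blacksquare A \mid \forall X A$ over propositional symbols $P\in\mathsf{Pr}$ and second-order variables $X$; closed = no free variables; $A[C/X]$ capture-avoiding substitution. A birelational structure $\mathfrak B$: set $W$ of worlds, partial order $\le$, class $\mathcal W\subseteq\mathcal P(W)$ of upward-closed sets, $P_{\mathfrak B}\in\mathcal W$ for each $P\in\mathsf{Pr}$, $R\subseteq W\times W$ with (i) $vRw\le w'\Rightarrow\exists v'\ge v$, $v'Rw'$; (ii) $v'\ge vRw\Rightarrow\exists w'\ge w$, $v'Rw'$. With each $V\in\mathcal W$ added as a symbol interpreted as $V$: $v\models P$ iff $v\in P_{\mathfrak B}$; $v\models A\to B$ iff $\forall v'\ge v$ ($v'\models A\Rightarrow v'\models B$); $v\models\Box A$ iff $\forall v'\ge v\,\forall w'$ ($v'Rw'\Rightarrow w'\models A$); $v\models\blacksquare A$ iff $\forall v'\ge v\,\forall u'$ ($u'Rv'\Rightarrow u'\models A$); $v\models\forall XA$ iff $\forall v'\ge v\,\forall V\in\mathcal W$, $v'\models A[V/X]$. $\models_{\mathfrak B}A$: true at every world. Birelational model: comprehensive, i.e. $\{w:w\models C\}\in\mathcal W$ for every closed $C$ of the expanded language. A predicate structure $\mathfrak P$: set $\Omega$ of states with partial order $\le$; set $W$ of modal worlds; set $\mathcal W\supseteq\mathsf{Pr}$ of sets;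 $V^a\subseteq W$ for $V\in\mathcal W$, $a\in\Omega$, with $a\le b\Rightarrow V^a\subseteq V^b$; $R^a\subseteq W\times W$ with $a\le b\Rightarrow R^a\subseteq R^b$. With each $V\in\mathcal W$ as a symbol: $a,v\models P$ iff $v\in P^a$; $a,v\models A\to B$ iff $\forall b\ge a$ ($b,v\models A\Rightarrow b,v\models B$); $a,v\models\Box A$ iff $\forall b\ge a\,\forall w$ ($vR^bw\Rightarrow b,w\models A$); $a,v\models\blacksquare A$ iff $\forall b\ge a\,\forall u$ ($uR^bv\Rightarrow b,u\models A$); $a,v\models\forall XA$ iff $\forall b\ge a\,\forall V\in\mathcal W$, $b,v\models A[V/X]$. $\models_{\mathfrak P}A$: $a,v\models A$ for all $a\in\Omega$, $v\in W$. Predicate model: comprehensive, i.e. for each closed $C$ of the expanded language there is $[C]\in\mathcal W$ with $[C]^a=\{w:a,w\models C\}$ for all $a$. -}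

module Defs where

open import Level using (Level; _⊔_) renaming (suc to lsuc)
open import Data.Nat using (ℕ; zero; suc)
open import Data.Fin using (Fin; zero; suc)
open import Data.Sum using (_⊎_; inj₁; inj₂)
open import Data.Product using (Σ; ∃; _×_; _,_)
open import Relation.Binary.PropositionalEquality using (_≡_)
open import Relation.Binary.Structures using (IsPartialOrder)

-- Syntax.  Form S n : formulas whose propositional symbols / set
-- constants range over S, with n free second-order variables
-- (de Bruijn indices).  Closed formulas are Form S 0.

data Form {a : Level} (S : Set a) : ℕ → Set a where
  atom : ∀ {n} → S → Form S n
  var  : ∀ {n} → Fin n → Form S n
  _⇒_  : ∀ {n} → Form S n → Form S n → Form S n
  □    : ∀ {n} → Form S n → Form S n
  ■    : ∀ {n} → Form S n → Form S n
  ∀'   : ∀ {n} → Form S (suc n) → Form S n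

infixr 5 _⇒_

-- renaming of symbols (used to view a formula over Pr as a formula
-- of the expanded language over Pr ⊎ 𝒲)
mapSym : ∀ {a b} {S : Set a} {T : Set b} {n} → (S → T) → Form S n → Form T n
mapSym f (atom s) = atom (f s)
mapSym f (var x)  = var x
mapSym f (A ⇒ B)  = mapSym f A ⇒ mapSym f B
mapSym f (□ A)    = □ (mapSym f A)
mapSym f (■ A)    = ■ (mapSym f A)
mapSym f (∀' A)   = ∀' (mapSym f A)

-- closing substitutions of constants for the free variables
-- (A[V₁/X₁,…,Vₙ/Xₙ] is evaluated lazily via such an environment)
[] : ∀ {a} {I : Set a} → Fin 0 → I
[] ()

_∷_ : ∀ {a} {I : Set a} {n} → I → (Fin n → I) → Fin (suc n) → I
(i ∷ σ) zero    = i
(i ∷ σ) (suc x) = σ x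

-- Birelational structures.  The class 𝒲 ⊆ 𝒫(W) is given as an indexed
-- family  ext : Idx → (W → Set ℓ)  of upward-closed subsets of W.

record BiStruct (Pr : Set) (ℓ : Level) : Set (lsuc ℓ) where
  field
    W      : Set ℓ
    _≤_    : W → W → Set ℓ
    ≤-po   : IsPartialOrder _≡_ _≤_
    Idx    : Set ℓ
    ext    : Idx → W → Set ℓ
    ext-up : ∀ i {v w} → v ≤ w → ext i v → ext i w
    prSet  : Pr → Idx
    R      : W → W → Set ℓ
    forth  : ∀ {v w w'} → R v w → w ≤ w' → ∃ λ v' → v ≤ v' × R v' w'
    back   : ∀ {v v' w} → v ≤ v' → R v w → ∃ λ w' → w ≤ w' × R v' w'

  Sym : Set ℓ
  Sym = Pr ⊎ Idx

  symSet : Sym → Idx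
  symSet (inj₁ P) = prSet P
  symSet (inj₂ V) = V

  sat : ∀ {n} → Form Sym n → (Fin n → Idx) → W → Set ℓ
  sat (atom s) σ v = ext (symSet s) v
  sat (var x)  σ v = ext (σ x) v
  sat (A ⇒ B)  σ v = ∀ v' → v ≤ v' → sat A σ v' → sat B σ v'
  sat (□ A)    σ v = ∀ v' w' → v ≤ v' → R v' w' → sat A σ w'
  sat (■ A)    σ v = ∀ v' u' → v ≤ v' → R u' v' → sat A σ u'
  sat (∀' A)   σ v = ∀ v' → v ≤ v' → (V : Idx) → sat A (V ∷ σ) v'

  _⊨_ : W → Form Sym 0 → Set ℓ
  v ⊨ C = sat C [] v

  Comprehensive : Set ℓ
  Comprehensive = (C : Form Sym 0) → Σ Idx λ V →
    ∀ w → (ext V w → w ⊨ C) × (w ⊨ C → ext V w)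

record BiModel (Pr : Set) (ℓ : Level) : Set (lsuc ℓ) where
  field
    struct        : BiStruct Pr ℓ
  open BiStruct struct public
  field
    comprehensive : Comprehensive

BiValid : ∀ {Pr ℓ} → BiModel Pr ℓ → Form Pr 0 → Set ℓ
BiValid 𝔅 A = ∀ v → v ⊨ mapSym inj₁ A
  where open BiModel 𝔅

-- Predicate structures.  𝒲 is an index type Idx with the propositional
-- symbols among its elements (prSet : Pr → Idx), and V^a = ext V a.

record PredStruct (Pr : Set) (ℓ : Level) : Set (lsuc ℓ) where
  field
    Ω        : Set ℓ
    _≤_      : Ω → Ω → Set ℓ
    ≤-po     : IsPartialOrder _≡_ _≤_
    W        : Set ℓ
    Idx      : Set ℓ
    prSet    : Pr → Idx
    ext      : Idx → Ω → W → Set ℓ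
    ext-mono : ∀ V {a b v} → a ≤ b → ext V a v → ext V b v
    R        : Ω → W → W → Set ℓ
    R-mono   : ∀ {a b v w} → a ≤ b → R a v w → R b v w

  Sym : Set ℓ
  Sym = Pr ⊎ Idx

  symSet : Sym → Idx
  symSet (inj₁ P) = prSet P
  symSet (inj₂ V) = V

  sat : ∀ {n} → Form Sym n → (Fin n → Idx) → Ω → W → Set ℓ
  sat (atom s) σ a v = ext (symSet s) a v
  sat (var x)  σ a v = ext (σ x) a v
  sat (A ⇒ B)  σ a v = ∀ b → a ≤ b → sat A σ b v → sat B σ b v
  sat (□ A)    σ a v = ∀ b w → a ≤ b → R b v w → sat A σ b w
  sat (■ A)    σ a v = ∀ b u → a ≤ b → R b u v → sat A σ b u
  sat (∀' A)   σ a v = ∀ b → a ≤ b → (V : Idx) → sat A (V ∷ σ) b v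

  _,_⊨_ : Ω → W → Form Sym 0 → Set ℓ
  a , v ⊨ C = sat C [] a v

  Comprehensive : Set ℓ
  Comprehensive = (C : Form Sym 0) → Σ Idx λ V →
    ∀ a w → (ext V a w → a , w ⊨ C) × (a , w ⊨ C → ext V a w)

record PredModel (Pr : Set) (ℓ : Level) : Set (lsuc ℓ) where
  field
    struct        : PredStruct Pr ℓ
  open PredStruct struct public
  field
    comprehensive : Comprehensive

PredValid : ∀ {Pr ℓ} → PredModel Pr ℓ → Form Pr 0 → Set ℓ
PredValid 𝔓 A = ∀ a v → a , v ⊨ mapSym inj₁ A
  where open PredModel 𝔓

-- A predicate structure 𝔓 unfolds into a birelational structure whose worlds are
-- the pairs (a , v) of a state and a modal world: the order moves the state and
-- keeps v, the relation moves the modal world along R^a and keeps a.  Monotonicity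
-- of R in the state gives the two frame conditions, and by induction on formulas
-- (a , v) ⊨ A holds in the unfolding iff a , v ⊨ A holds in 𝔓.  Hence the unfolding
-- of a predicate model is comprehensive, and a formula valid in it is valid in 𝔓.
module Submission where

open import Defs
open import Level using (Level)
open import Data.Sum using (inj₁; inj₂)
open import Data.Product using (Σ; _×_; _,_; proj₁; proj₂)
open import Function using (id)
open import Function.Bundles using (_⇔_; mk⇔; Equivalence)
open import Relation.Binary.PropositionalEquality using (_≡_; refl; cong₂; isEquivalence)
open import Relation.Binary.Structures using (IsPartialOrder)

open Equivalence using (to; from)

module Unfolding {Pr : Set} {ℓ : Level} (𝔓 : PredStruct Pr ℓ) where
  open PredStruct 𝔓
  private module Ω = IsPartialOrder ≤-po

  World : Set ℓ
  World = Ω × W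

  _⊑_ : World → World → Set ℓ
  (a , v) ⊑ (b , w) = a ≤ b × v ≡ w

  _⟶_ : World → World → Set ℓ
  (a , v) ⟶ (b , w) = a ≡ b × R a v w

  ⊑-isPartialOrder : IsPartialOrder _≡_ _⊑_
  ⊑-isPartialOrder = record
    { isPreorder = record
      { isEquivalence = isEquivalence
      ; reflexive     = λ { refl → Ω.refl , refl }
      ; trans         = λ { (a≤b , refl) (b≤c , refl) → Ω.trans a≤b b≤c , refl }
      }
    ; antisym = λ { (a≤b , refl) (b≤a , refl) → cong₂ _,_ (Ω.antisym a≤b b≤a) refl }
    }

  forth : ∀ {x y y′} → x ⟶ y → y ⊑ y′ → Σ World λ x′ → x ⊑ x′ × x′ ⟶ y′
  forth {a , v} {_ , w} {b , _} (refl , vRw) (a≤b , refl) =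
    (b , v) , (a≤b , refl) , (refl , R-mono a≤b vRw)

  back : ∀ {x x′ y} → x ⊑ x′ → x ⟶ y → Σ World λ y′ → y ⊑ y′ × x′ ⟶ y′
  back {a , v} {b , _} {_ , w} (a≤b , refl) (refl , vRw) =
    (b , w) , (a≤b , refl) , (refl , R-mono a≤b vRw)

  unfold : BiStruct Pr ℓ
  unfold = record
    { W      = World
    ; _≤_    = _⊑_
    ; ≤-po   = ⊑-isPartialOrder
    ; Idx    = Idx
    ; ext    = λ { V (a , v) → ext V a v }
    ; ext-up = λ { V (a≤b , refl) → ext-mono V a≤b }
    ; prSet  = prSet
    ; R      = _⟶_
    ; forth  = forth
    ; back   = back
    }

  private module 𝔅 = BiStruct unfold

  sat⇔ : ∀ {n} (A : Form Sym n) σ a v → 𝔅.sat A σ (a , v) ⇔ sat A σ a v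
  sat⇔ (atom (inj₁ P)) σ a v = mk⇔ id id
  sat⇔ (atom (inj₂ V)) σ a v = mk⇔ id id
  sat⇔ (var x) σ a v = mk⇔ id id
  sat⇔ (A ⇒ B) σ a v = mk⇔
    (λ h b a≤b A↓ → to (sat⇔ B σ b v) (h (b , v) (a≤b , refl) (from (sat⇔ A σ b v) A↓)))
    (λ { h (b , _) (a≤b , refl) A↑ → from (sat⇔ B σ b v) (h b a≤b (to (sat⇔ A σ b v) A↑)) })
  sat⇔ (□ A) σ a v = mk⇔
    (λ h b w a≤b vRw → to (sat⇔ A σ b w) (h (b , v) (b , w) (a≤b , refl) (refl , vRw)))
    (λ { h (b , _) (_ , w) (a≤b , refl) (refl , vRw) → from (sat⇔ A σ b w) (h b w a≤b vRw) })
  sat⇔ (■ A) σ a v = mk⇔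
    (λ h b u a≤b uRv → to (sat⇔ A σ b u) (h (b , v) (b , u) (a≤b , refl) (refl , uRv)))
    (λ { h (b , _) (_ , u) (a≤b , refl) (refl , uRv) → from (sat⇔ A σ b u) (h b u a≤b uRv) })
  sat⇔ (∀' A) σ a v = mk⇔
    (λ h b a≤b V → to (sat⇔ A (V ∷ σ) b v) (h (b , v) (a≤b , refl) V))
    (λ { h (b , _) (a≤b , refl) V → from (sat⇔ A (V ∷ σ) b v) (h b a≤b V) })

  unfold-comprehensive : Comprehensive → 𝔅.Comprehensive
  unfold-comprehensive comp C with comp C
  ... | V , V≡C = V , λ { (a , w) →
          (λ V∋ → from (sat⇔ C [] a w) (proj₁ (V≡C a w) V∋))
        , (λ C↑ → proj₂ (V≡C a w) (to (sat⇔ C [] a w) C↑)) }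

unfoldModel : ∀ {Pr ℓ} → PredModel Pr ℓ → BiModel Pr ℓ
unfoldModel 𝔓 = record
  { struct        = Unfolding.unfold struct
  ; comprehensive = Unfolding.unfold-comprehensive struct comprehensive
  }
  where open PredModel 𝔓

proposition3p10 : (Pr : Set) (A : Form Pr 0) →
    (∀ {ℓ} (𝔅 : BiModel Pr ℓ) → BiValid 𝔅 A) →
    ∀ {ℓ} (𝔓 : PredModel Pr ℓ) → PredValid 𝔓 A
proposition3p10 Pr A valid 𝔓 a v =
  to (Unfolding.sat⇔ (PredModel.struct 𝔓) (mapSym inj₁ A) [] a v)
     (valid (unfoldModel 𝔓) (a , v))
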